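{- Let $\alpha\in\{0,1,2\}^\omega$ contain infinitely many $1$s or infinitely many $2$s. Then there exists an $\mathrm{MSO}$ interpretation $\Theta$ such that $\Theta(\mathcal{S}_\alpha)$ contains (isomorphic copies of) all square grids.
   Context: For $\alpha=\alpha_0\alpha_1\cdots\in\{0,1,2\}^\omega$, $\mathcal{P}_\alpha$ is the infinite graph with vertex set $\{v_{i,j}: i,j\in\mathbb{N}\}$, where there is no edge between $v_{i,j}$ and $v_{i',j'}$ unless $|j-j'|=1$, and edges between consecutive columns are given by: if $\alpha_j=0$, $\{v_{i,j},v_{k,j+1}\}$ is an edge iff $i=k$; if $\alpha_j=1$, iff $i\ne k$; if $\alpha_j=2$, iff $i\le k$. $\mathcal{S}_\alpha$ is the class of all finite induced subgraphs of $\mathcal{P}_\alpha$. An $\mathrm{MSO}$ interpretation with parameters $\bar Z=(Z_1,\dots,Z_l)$ (set variables) is a tuple $\Psi(\bar Z)=(\psi(x,\bar Z),\psi_E(x,y,\bar Z))$ of $\mathrm{MSO}$ formulas over the graph vocabulary; for a graph $G$ and subsets $\bar A$ of $V(G)$, $\Psi((G,\bar A))$ is the structure with vertex set $\{a:G\models\psi(a,\bar A)\}$ and edge relation $\{(a,b):G\models\psi_E(a,b,\bar A)\}$, and $\Psi(\mathcal{C})=\{\Psi((G,\bar A)): G\in\mathcal{C}, \bar A \text{ arbitrary}\}$. The $n\times n$ grid has vertices $(i,j)$, $1\le i,j\le n$, with $(i,j)$ adjacent to $(i,j+1)$ and $(i+1,j)$ when these exist. -}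

module Defs where

open import Data.Nat using (ℕ; zero; suc; _≤_)
open import Data.Fin using (Fin)
open import Data.Fin.Subset using (Subset; _∈_)
open import Data.Bool using (Bool; true)
open import Data.Product using (Σ; _×_; _,_; ∃; ∃-syntax)
open import Data.Sum using (_⊎_)
open import Relation.Nullary using (¬_)
open import Relation.Binary.PropositionalEquality using (_≡_; _≢_)
open import Function.Bundles using (_⇔_)
open import Function.Definitions using (Injective)

data Letter : Set where
  l0 l1 l2 : Letter

-- Edge rule between column j (vertex row i) and column j+1 (row k)
ColRel : Letter → ℕ → ℕ → Set
ColRel l0 i k = i ≡ k
ColRel l1 i k = i ≢ k
ColRel l2 i k = i ≤ k

-- vertex v_{i,j} is represented by the pair (i , j)
PAdj : (ℕ → Letter) → ℕ × ℕ → ℕ × ℕ → Set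
PAdj α (i , j) (k , j') =
  (j' ≡ suc j × ColRel (α j) i k) ⊎ (j ≡ suc j' × ColRel (α j') k i)

record Graph : Set where
  field
    size : ℕ
    adj  : Fin size → Fin size → Bool
open Graph public

InSα : (ℕ → Letter) → Graph → Set
InSα α G =
  Σ (Fin (size G) → ℕ × ℕ) λ g →
    Injective _≡_ _≡_ g ×
    (∀ a b → (adj G a b ≡ true) ⇔ PAdj α (g a) (g b))

-- MSO over the graph vocabulary.
-- Formula k m : k free first-order variables, m free set variables
-- (de Bruijn style, indexed by Fin).

data Formula : ℕ → ℕ → Set where
  edge : ∀ {k m} → Fin k → Fin k → Formula k m
  eq   : ∀ {k m} → Fin k → Fin k → Formula k m
  mem  : ∀ {k m} → Fin k → Fin m → Formula k m
  neg  : ∀ {k m} → Formula k m → Formula k m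
  and  : ∀ {k m} → Formula k m → Formula k m → Formula k m
  ex₁  : ∀ {k m} → Formula (suc k) m → Formula k m
  ex₂  : ∀ {k m} → Formula k (suc m) → Formula k m

extend : ∀ {k} {A : Set} → A → (Fin k → A) → Fin (suc k) → A
extend a ρ Fin.zero    = a
extend a ρ (Fin.suc i) = ρ i

Sat : (G : Graph) → ∀ {k m} → (Fin k → Fin (size G)) →
      (Fin m → Subset (size G)) → Formula k m → Set
Sat G ρ σ (edge x y) = adj G (ρ x) (ρ y) ≡ true
Sat G ρ σ (eq x y)   = ρ x ≡ ρ y
Sat G ρ σ (mem x X)  = ρ x ∈ σ X
Sat G ρ σ (neg φ)    = ¬ Sat G ρ σ φ
Sat G ρ σ (and φ ψ)  = Sat G ρ σ φ × Sat G ρ σ ψ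
Sat G ρ σ (ex₁ φ)    = ∃[ a ] Sat G (extend a ρ) σ φ
Sat G ρ σ (ex₂ φ)    = ∃[ A ] Sat G ρ (extend A σ) φ

-- An MSO interpretation with l set parameters: (ψ(x,Z̄), ψ_E(x,y,Z̄)).
record Interpretation (l : ℕ) : Set where
  field
    dom  : Formula 1 l
    edgE : Formula 2 l
open Interpretation public

one : ∀ {n} → Fin n → Fin 1 → Fin n
one a _ = a

two : ∀ {n} → Fin n → Fin n → Fin 2 → Fin n
two a b Fin.zero    = a
two a b (Fin.suc _) = b

GridAdj : ∀ {n} → Fin n × Fin n → Fin n × Fin n → Set
GridAdj (i , j) (i' , j') =
  (i ≡ i' × (Data.Fin.toℕ j' ≡ suc (Data.Fin.toℕ j) ⊎ Data.Fin.toℕ j ≡ suc (Data.Fin.toℕ j'))) ⊎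
  (j ≡ j' × (Data.Fin.toℕ i' ≡ suc (Data.Fin.toℕ i) ⊎ Data.Fin.toℕ i ≡ suc (Data.Fin.toℕ i')))

InterpIsoGrid : ∀ {l} → Interpretation l → (G : Graph) →
                (Fin l → Subset (size G)) → ℕ → Set
InterpIsoGrid Θ G A n =
  Σ (Fin n × Fin n → Fin (size G)) λ f →
    Injective _≡_ _≡_ f ×
    (∀ a → Sat G (one a) A (dom Θ) ⇔ (∃[ p ] f p ≡ a)) ×
    (∀ p q → GridAdj p q ⇔ Sat G (two (f p) (f q)) A (edgE Θ))

InfinitelyMany : (ℕ → Letter) → Letter → Set
InfinitelyMany α c = ∀ N → ∃[ j ] (N ≤ j × α j ≡ c)

-- Let q 0 < q 1 < ... enumerate the columns of P_α whose letter is 1 (or all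
-- whose letter is 2), and for a given n take the induced subgraph of P_α on rows
-- < n + 3 and columns ≤ q (2n) + 1.  With the residues mod 3 of the columns and
-- their letters as set parameters, MSO defines the step v_{i,j} ↦ v_{i,j+1}
-- along a row (by a formula depending on the letter α j), hence, as a least
-- fixed point, "y lies right of x in its row with no vertex of B in between".
-- The grid vertex (i , j) is v_{i, q j}: two of them are horizontally adjacent
-- iff no grid vertex lies between them, and vertically adjacent iff they share a
-- column (a common neighbour in the next column, which letters 1 and 2 provide)
-- and the markers v_{i, q (n + i)} of their rows lie in consecutive columns
-- among q n, ..., q (2n − 1).

module Submission where

open import Defs
open import Data.Bool using (true)
open import Data.Empty using (⊥-elim)
open import Data.Fin as Fin using (Fin; toℕ; fromℕ<; combine; remQuot; #_)
open import Data.Fin.Properties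
  using (toℕ<n; toℕ-fromℕ<; toℕ-injective; remQuot-combine; combine-remQuot; any?; all?)
open import Data.Fin.Subset using (Subset; _∈_; _∉_; ⊥)
open import Data.Fin.Subset.Properties using (_∈?_; ∉⊥)
open import Data.Nat using (ℕ; zero; suc; _+_; _*_; _∸_; _≤_; _<_; z≤n; s≤s; _≟_; _≤?_; _<?_)
open import Data.Nat.Properties
open import Data.Product using (Σ; _×_; _,_; proj₁; proj₂; ∃-syntax)
open import Data.Sum using (_⊎_; inj₁; inj₂)
open import Data.Vec using (tabulate; lookup; _∷_; [])
open import Data.Vec.Properties using (lookup∘tabulate; []=⇒lookup; lookup⇒[]=)
open import Function using (_∘_; case_of_)
open import Function.Bundles using (_⇔_; mk⇔; Equivalence)
open import Function.Properties.Equivalence using () renaming (trans to ⇔-trans; sym to ⇔-sym)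
open import Relation.Binary.PropositionalEquality
open import Relation.Nullary using (Dec; yes; no; does; ¬_)
open import Relation.Nullary.Decidable using (dec-true; decidable-stable; _×-dec_; _⊎-dec_; ¬?; _→-dec_)

open Equivalence using (to; from)

dec-true⁻¹ : ∀ {P : Set} (P? : Dec P) → does P? ≡ true → P
dec-true⁻¹ (yes p) _  = p
dec-true⁻¹ (no _)  ()

toSubset : ∀ {n} {P : Fin n → Set} → (∀ v → Dec (P v)) → Subset n
toSubset P? = tabulate (λ v → does (P? v))

∈-toSubset : ∀ {n} {P : Fin n → Set} (P? : ∀ v → Dec (P v)) {v : Fin n} → v ∈ toSubset P? ⇔ P v
∈-toSubset P? {v} = mk⇔
  (λ v∈ → dec-true⁻¹ (P? v) (trans (sym (lookup∘tabulate _ v)) ([]=⇒lookup v∈)))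
  (λ p  → lookup⇒[]= v _ (trans (lookup∘tabulate _ v) (dec-true (P? v) p)))

¬∧¬⇔⊎ : ∀ {A B A′ B′ : Set} → A ⇔ A′ → B ⇔ B′ → Dec (A′ ⊎ B′) → (¬ (¬ A × ¬ B)) ⇔ (A′ ⊎ B′)
¬∧¬⇔⊎ A⇔ B⇔ A′⊎B′? = mk⇔
  (λ k → decidable-stable A′⊎B′? λ ¬a⊎b →
    k ((λ a → ¬a⊎b (inj₁ (to A⇔ a))) , (λ b → ¬a⊎b (inj₂ (to B⇔ b)))))
  λ { (inj₁ a) (¬a , _) → ¬a (from A⇔ a)
    ; (inj₂ b) (_ , ¬b) → ¬b (from B⇔ b) }

avoid-two : (r r′ : ℕ) → Σ ℕ λ z → z < 3 × z ≢ r × z ≢ r′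
avoid-two 0             0             = 1 , s≤s (s≤s z≤n) , (λ ()) , (λ ())
avoid-two 0             1             = 2 , s≤s (s≤s (s≤s z≤n)) , (λ ()) , (λ ())
avoid-two 0             (suc (suc _)) = 1 , s≤s (s≤s z≤n) , (λ ()) , (λ ())
avoid-two 1             0             = 2 , s≤s (s≤s (s≤s z≤n)) , (λ ()) , (λ ())
avoid-two 1             (suc _)       = 0 , s≤s z≤n , (λ ()) , (λ ())
avoid-two (suc (suc _)) 0             = 1 , s≤s (s≤s z≤n) , (λ ()) , (λ ())
avoid-two (suc (suc _)) (suc _)       = 0 , s≤s z≤n , (λ ()) , (λ ())

module StrictlyIncreasing (q : ℕ → ℕ) (q-step : ∀ t → q t < q (suc t)) where

  mono-< : ∀ {s t} → s < t → q s < q t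
  mono-< {s} {suc t} (s≤s s≤t) with m≤n⇒m<n∨m≡n s≤t
  ... | inj₁ s<t  = <-trans (mono-< s<t) (q-step t)
  ... | inj₂ refl = q-step t

  mono-≤ : ∀ {s t} → s ≤ t → q s ≤ q t
  mono-≤ s≤t with m≤n⇒m<n∨m≡n s≤t
  ... | inj₁ s<t  = <⇒≤ (mono-< s<t)
  ... | inj₂ refl = ≤-refl

  cancel-< : ∀ {s t} → q s < q t → s < t
  cancel-< qs<qt = ≰⇒> λ t≤s → <⇒≱ qs<qt (mono-≤ t≤s)

  injective : ∀ {s t} → q s ≡ q t → s ≡ t
  injective qs≡qt = ≤-antisym (≮⇒≥ λ t<s → <⇒≢ (mono-< t<s) (sym qs≡qt))
                              (≮⇒≥ λ s<t → <⇒≢ (mono-< s<t) qs≡qt)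

enumerate : ∀ {α c} → InfinitelyMany α c →
            Σ (ℕ → ℕ) λ q → (∀ t → α (q t) ≡ c) × (∀ t → q t < q (suc t))
enumerate {α} {c} inf = q , q-letter , λ t → proj₁ (proj₂ (inf (suc (q t))))
  where
  q : ℕ → ℕ
  q zero    = proj₁ (inf 0)
  q (suc t) = proj₁ (inf (suc (q t)))
  q-letter : ∀ t → α (q t) ≡ c
  q-letter zero    = proj₂ (proj₂ (inf 0))
  q-letter (suc t) = proj₂ (proj₂ (inf (suc (q t))))

enumerate-nonzero : ∀ {α} → InfinitelyMany α l1 ⊎ InfinitelyMany α l2 →
                    Σ (ℕ → ℕ) λ q → (∀ t → α (q t) ≢ l0) × (∀ t → q t < q (suc t))
enumerate-nonzero (inj₁ often) = let (q , q₁ , q-step) = enumerate often in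
  q , (λ t q₀ → case (trans (sym (q₁ t)) q₀) of λ ()) , q-step
enumerate-nonzero (inj₂ often) = let (q , q₂ , q-step) = enumerate often in
  q , (λ t q₀ → case (trans (sym (q₂ t)) q₀) of λ ()) , q-step

data Residue : Set where
  r₀ r₁ r₂ : Residue

rsuc : Residue → Residue
rsuc r₀ = r₁
rsuc r₁ = r₂
rsuc r₂ = r₀

residue : ℕ → Residue
residue 0                   = r₀
residue 1                   = r₁
residue 2                   = r₂
residue (suc (suc (suc n))) = residue n

residue-suc : ∀ n → residue (suc n) ≡ rsuc (residue n)
residue-suc 0                   = refl
residue-suc 1                   = refl
residue-suc 2                   = refl
residue-suc (suc (suc (suc n))) = residue-suc n

rsuc²-irrefl : ∀ z → rsuc (rsuc z) ≢ z
rsuc²-irrefl r₀ ()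
rsuc²-irrefl r₁ ()
rsuc²-irrefl r₂ ()

residue-suc²-≢ : ∀ c → residue (suc (suc c)) ≢ residue c
residue-suc²-≢ c e = rsuc²-irrefl (residue c)
  (trans (sym (trans (residue-suc (suc c)) (cong rsuc (residue-suc c)))) e)

_≟ʳ_ : (z z′ : Residue) → Dec (z ≡ z′)
r₀ ≟ʳ r₀ = yes refl
r₀ ≟ʳ r₁ = no λ ()
r₀ ≟ʳ r₂ = no λ ()
r₁ ≟ʳ r₀ = no λ ()
r₁ ≟ʳ r₁ = yes refl
r₁ ≟ʳ r₂ = no λ ()
r₂ ≟ʳ r₀ = no λ ()
r₂ ≟ʳ r₁ = no λ ()
r₂ ≟ʳ r₂ = yes refl

_≟ˡ_ : (a b : Letter) → Dec (a ≡ b)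
l0 ≟ˡ l0 = yes refl
l0 ≟ˡ l1 = no λ ()
l0 ≟ˡ l2 = no λ ()
l1 ≟ˡ l0 = no λ ()
l1 ≟ˡ l1 = yes refl
l1 ≟ˡ l2 = no λ ()
l2 ≟ˡ l0 = no λ ()
l2 ≟ˡ l1 = no λ ()
l2 ≟ˡ l2 = yes refl

colRel? : ∀ ℓ i k → Dec (ColRel ℓ i k)
colRel? l0 i k = i ≟ k
colRel? l1 i k = ¬? (i ≟ k)
colRel? l2 i k = i ≤? k

pAdj? : ∀ α a b → Dec (PAdj α a b)
pAdj? α (i , j) (k , j′) =
  ((j′ ≟ suc j) ×-dec colRel? (α j) i k) ⊎-dec ((j ≟ suc j′) ×-dec colRel? (α j′) k i)

_⇒ᶠ_ : ∀ {k l} → Formula k l → Formula k l → Formula k l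
φ ⇒ᶠ ψ = neg (and φ (neg ψ))

_∨ᶠ_ : ∀ {k l} → Formula k l → Formula k l → Formula k l
φ ∨ᶠ ψ = neg (and (neg φ) (neg ψ))

record Labels (l : ℕ) : Set where
  field
    residueˡ : Residue → Fin l
    letterˡ  : Letter → Fin l
open Labels

weaken : ∀ {l} → Labels l → Labels (suc l)
weaken L = record { residueˡ = Fin.suc ∘ residueˡ L ; letterˡ = Fin.suc ∘ letterˡ L }

module _ {k l : ℕ} (L : Labels l) where

  byResidue : Fin k → (Residue → Formula k l) → Formula k l
  byResidue x φ = and (case r₀) (and (case r₁) (case r₂))
    where case = λ z → mem x (residueˡ L z) ⇒ᶠ φ z

  byLetter : Fin k → (Letter → Formula k l) → Formula k l
  byLetter x φ = and (case l0) (and (case l1) (case l2))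
    where case = λ ℓ → mem x (letterˡ L ℓ) ⇒ᶠ φ ℓ

  residueMapᶠ : (Residue → Residue) → Fin k → Fin k → Formula k l
  residueMapᶠ f x y = byResidue x λ z → mem y (residueˡ L (f z))

  sameResidueᶠ nextResidueᶠ : Fin k → Fin k → Formula k l
  sameResidueᶠ = residueMapᶠ λ z → z
  nextResidueᶠ = residueMapᶠ rsuc

pattern #0 = Fin.zero
pattern #1 = Fin.suc Fin.zero

rowExceedsᶠ : ∀ {k l} → Labels l → Fin k → Fin k → Formula k l
rowExceedsᶠ L x y = ex₁ (and (sameResidueᶠ L #0 (Fin.suc x)) (and (edge (Fin.suc y) #0)
  (ex₁ (and (nextResidueᶠ L (Fin.suc (Fin.suc x)) #0) (and (edge (Fin.suc (Fin.suc x)) #0)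
    (neg (edge #1 #0)))))))

-- Letter 1: y is a non-neighbour of x in the next column joined to x by a path
-- x w u y with u in the column of x.  Letter 2: y is a neighbour of x in the
-- next column (so row x ≤ row y) and no z in the column of x adjacent to y
-- misses a right neighbour w of x (so row y ≤ row x).
rightStepᶠ : ∀ {k l} → Letter → Labels l → Fin k → Fin k → Formula k l
rightStepᶠ l0 L x y = and (nextResidueᶠ L x y) (edge x y)
rightStepᶠ l1 L x y = and (nextResidueᶠ L x y) (and (neg (edge x y))
  (ex₁ (ex₁ (and (edge (Fin.suc (Fin.suc x)) #1) (and (edge #1 #0)
    (and (edge #0 (Fin.suc (Fin.suc y))) (sameResidueᶠ L #0 (Fin.suc (Fin.suc x)))))))))
rightStepᶠ l2 L x y = and (nextResidueᶠ L x y) (and (edge x y) (neg (rowExceedsᶠ L x y)))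

rightᶠ : ∀ {k l} → Labels l → Fin k → Fin k → Formula k l
rightᶠ L x y = byLetter L x λ ℓ → rightStepᶠ ℓ L x y

rightNeighbour∈ᶠ : ∀ {k l} → Labels l → Fin k → Fin l → Formula k l
rightNeighbour∈ᶠ L x X = neg (ex₁ (and (rightᶠ L (Fin.suc x) #0) (neg (mem #0 X))))

closedRightOutsideᶠ : ∀ {k l} → Labels l → Fin l → Fin l → Formula k l
closedRightOutsideᶠ L B X = neg (ex₁ (ex₁ (and (mem #1 X) (and (neg (mem #1 B))
                                (and (rightᶠ L #1 #0) (neg (mem #0 X)))))))

-- y lies in every set X that contains the right neighbour of x and is closed
-- under right steps out of vertices not in B.
unblockedᶠ : ∀ {k l} → Labels l → Fin l → Fin k → Fin k → Formula k l
unblockedᶠ L B x y = neg (ex₂ (and (rightNeighbour∈ᶠ (weaken L) x #0)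
                              (and (closedRightOutsideᶠ (weaken L) (Fin.suc B) #0) (neg (mem y #0)))))

sameColumnᶠ : ∀ {k l} → Labels l → Fin k → Fin k → Formula k l
sameColumnᶠ L x y = and (sameResidueᶠ L x y)
  (ex₁ (and (edge (Fin.suc x) #0) (and (edge (Fin.suc y) #0) (nextResidueᶠ L (Fin.suc x) #0))))

module Rectangle (α : ℕ → Letter) (m W : ℕ) (3≤m : 3 ≤ m) where

  V : Set
  V = Fin (m * W)

  row col : V → ℕ
  row v = toℕ (proj₁ (remQuot {m} W v))
  col v = toℕ (proj₂ (remQuot {m} W v))

  row< : ∀ v → row v < m
  row< v = toℕ<n _

  col< : ∀ v → col v < W
  col< v = toℕ<n _

  vertex : ∀ {r c} → r < m → c < W → V
  vertex r<m c<W = combine (fromℕ< r<m) (fromℕ< c<W)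

  row-vertex : ∀ {r c} (r<m : r < m) (c<W : c < W) → row (vertex r<m c<W) ≡ r
  row-vertex r<m c<W =
    trans (cong (toℕ ∘ proj₁) (remQuot-combine (fromℕ< r<m) (fromℕ< c<W))) (toℕ-fromℕ< r<m)

  col-vertex : ∀ {r c} (r<m : r < m) (c<W : c < W) → col (vertex r<m c<W) ≡ c
  col-vertex r<m c<W =
    trans (cong (toℕ ∘ proj₂) (remQuot-combine (fromℕ< r<m) (fromℕ< c<W))) (toℕ-fromℕ< c<W)

  vertex-ext : ∀ {a b} → row a ≡ row b → col a ≡ col b → a ≡ b
  vertex-ext {a} {b} ra≡rb ca≡cb = begin
    a                                ≡⟨ combine-remQuot {m} W a ⟨
    combine (proj₁ ra) (proj₂ ra)    ≡⟨ cong₂ combine (toℕ-injective ra≡rb) (toℕ-injective ca≡cb) ⟩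
    combine (proj₁ rb) (proj₂ rb)    ≡⟨ combine-remQuot {m} W b ⟩
    b                                ∎
    where
    open ≡-Reasoning
    ra = remQuot {m} W a
    rb = remQuot {m} W b

  position : V → ℕ × ℕ
  position v = row v , col v

  Adj : V → V → Set
  Adj a b = PAdj α (position a) (position b)

  graph : Graph
  graph = record { size = m * W ; adj = λ a b → does (pAdj? α (position a) (position b)) }

  adj⇔Adj : ∀ a b → (adj graph a b ≡ true) ⇔ Adj a b
  adj⇔Adj a b = mk⇔ (dec-true⁻¹ (pAdj? α _ _)) (dec-true (pAdj? α _ _))

  graph∈Sα : InSα α graph
  graph∈Sα = position , (λ e → vertex-ext (cong proj₁ e) (cong proj₂ e)) , adj⇔Adj

  Adj-sym : ∀ {a b} → Adj a b → Adj b a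
  Adj-sym (inj₁ ab) = inj₂ ab
  Adj-sym (inj₂ ba) = inj₁ ba

  Adj-columns : ∀ {a b} → Adj a b → col b ≡ suc (col a) ⊎ col a ≡ suc (col b)
  Adj-columns (inj₁ (e , _)) = inj₁ e
  Adj-columns (inj₂ (e , _)) = inj₂ e

  Adj⇒ColRel : ∀ {a b ℓ} → α (col a) ≡ ℓ → Adj a b → col b ≡ suc (col a) →
               ColRel ℓ (row a) (row b)
  Adj⇒ColRel refl (inj₁ (_ , r)) _  = r
  Adj⇒ColRel refl (inj₂ (e , _)) e′ = ⊥-elim (<-asym (≤-reflexive (sym e′)) (≤-reflexive (sym e)))

  ColRel⇒Adj : ∀ {a b ℓ} → α (col a) ≡ ℓ → col b ≡ suc (col a) →
               ColRel ℓ (row a) (row b) → Adj a b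
  ColRel⇒Adj refl e r = inj₁ (e , r)

  -- Residues mod 3 of the columns orient the graph: they tell the column of a
  -- neighbour apart from the column on the other side.
  Adj-right : ∀ {a b} → Adj a b → residue (col b) ≡ rsuc (residue (col a)) → col b ≡ suc (col a)
  Adj-right {a} {b} ab ρb with Adj-columns ab
  ... | inj₁ right = right
  ... | inj₂ left  = ⊥-elim (rsuc²-irrefl (residue (col b)) (begin
    rsuc (rsuc (residue (col b)))  ≡⟨ cong rsuc (residue-suc (col b)) ⟨
    rsuc (residue (suc (col b)))   ≡⟨ cong (rsuc ∘ residue) left ⟨
    rsuc (residue (col a))         ≡⟨ ρb ⟨
    residue (col b)                ∎))
    where open ≡-Reasoning

  Adj²-sameColumn : ∀ {a w b} → Adj a w → Adj w b → residue (col b) ≡ residue (col a) →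
                    col b ≡ col a
  Adj²-sameColumn {a} {w} {b} aw wb ρb with Adj-columns aw | Adj-columns wb
  ... | inj₁ wa | inj₁ bw =
    ⊥-elim (residue-suc²-≢ (col a) (trans (cong residue (sym (trans bw (cong suc wa)))) ρb))
  ... | inj₁ wa | inj₂ wb = suc-injective (trans (sym wb) wa)
  ... | inj₂ aw | inj₁ bw = trans bw (sym aw)
  ... | inj₂ aw | inj₂ wb =
    ⊥-elim (residue-suc²-≢ (col b) (trans (cong residue (sym (trans aw (cong suc wb)))) (sym ρb)))

  RightStep : V → V → Set
  RightStep a b = row b ≡ row a × col b ≡ suc (col a)

  rightStep? : ∀ a b → Dec (RightStep a b)
  rightStep? a b = (row b ≟ row a) ×-dec (col b ≟ suc (col a))

  Unblocked : Subset (m * W) → V → V → Set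
  Unblocked B a b = row b ≡ row a × col a < col b ×
                    (∀ v → row v ≡ row a → col a < col v → col v < col b → v ∉ B)

  unblocked? : ∀ B a b → Dec (Unblocked B a b)
  unblocked? B a b = (row b ≟ row a) ×-dec (col a <? col b) ×-dec
    all? (λ v → (row v ≟ row a) →-dec ((col a <? col v) →-dec ((col v <? col b) →-dec ¬? (v ∈? B))))

  residueIs? : ∀ z v → Dec (residue (col v) ≡ z)
  residueIs? z v = residue (col v) ≟ʳ z

  letterIs? : ∀ ℓ v → Dec (α (col v) ≡ ℓ)
  letterIs? ℓ v = α (col v) ≟ˡ ℓ

  record Labelled {l} (L : Labels l) (σ : Fin l → Subset (m * W)) : Set where
    field
      residue-set : ∀ z → σ (residueˡ L z) ≡ toSubset (residueIs? z)
      letter-set  : ∀ ℓ → σ (letterˡ L ℓ) ≡ toSubset (letterIs? ℓ)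
  open Labelled

  weaken-labelled : ∀ {l L σ} X → Labelled {l} L σ → Labelled (weaken L) (extend X σ)
  weaken-labelled X lab = record { residue-set = residue-set lab ; letter-set = letter-set lab }

  adj⇒Adj : ∀ {a b} → adj graph a b ≡ true → Adj a b
  adj⇒Adj = to (adj⇔Adj _ _)

  Adj⇒adj : ∀ {a b} → Adj a b → adj graph a b ≡ true
  Adj⇒adj = from (adj⇔Adj _ _)

  residue-right : ∀ {a b} → col b ≡ suc (col a) → residue (col b) ≡ rsuc (residue (col a))
  residue-right {a} c = trans (cong residue c) (residue-suc (col a))

  commonRightNeighbour : ∀ {a b} → α (col a) ≢ l0 → col b ≡ col a → suc (col a) < W →
                         Σ V λ w → col w ≡ suc (col a) × Adj a w × Adj b w
  commonRightNeighbour {a} {b} ¬a₀ cb c<W = cases (α (col a)) refl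
    where
    cases : ∀ ℓ → α (col a) ≡ ℓ → Σ V λ w → col w ≡ suc (col a) × Adj a w × Adj b w
    cases l0 a₀ = ⊥-elim (¬a₀ a₀)
    cases l1 a₁ = w , cw , ColRel⇒Adj a₁ cw a≢w ,
                     ColRel⇒Adj (trans (cong α cb) a₁) (trans cw (cong suc (sym cb))) b≢w
      where
      avoid = avoid-two (row a) (row b)
      rw<m = ≤-trans (proj₁ (proj₂ avoid)) 3≤m
      w = vertex rw<m c<W
      cw = col-vertex rw<m c<W
      rw = row-vertex rw<m c<W
      a≢w : row a ≢ row w
      a≢w e = proj₁ (proj₂ (proj₂ avoid)) (trans (sym rw) (sym e))
      b≢w : row b ≢ row w
      b≢w e = proj₂ (proj₂ (proj₂ avoid)) (trans (sym rw) (sym e))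
    cases l2 a₂ = w , cw , ColRel⇒Adj a₂ cw (subst (row a ≤_) (sym rw) (m≤m⊔n (row a) (row b))) ,
                     ColRel⇒Adj (trans (cong α cb) a₂) (trans cw (cong suc (sym cb)))
                       (subst (row b ≤_) (sym rw) (m≤n⊔m (row a) (row b)))
      where
      rw<m = ⊔-lub (row< a) (row< b)
      w = vertex rw<m c<W
      cw = col-vertex rw<m c<W
      rw = row-vertex rw<m c<W

  RightStep⇒Unblocked : ∀ {B a b} → RightStep a b → Unblocked B a b
  RightStep⇒Unblocked (r , c) = r , ≤-reflexive (sym c) ,
    λ v _ a<v v<b → ⊥-elim (<-irrefl refl (<-≤-trans a<v (≤-pred (subst (_ <_) c v<b))))

  Unblocked-step : ∀ {B a v w} → Unblocked B a v → v ∉ B → RightStep v w → Unblocked B a w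
  Unblocked-step {B} {a} {v} {w} (rv , a<v , clear) v∉B (rw , cw) =
    trans rw rv , <-trans a<v (≤-reflexive (sym cw)) , clear′
    where
    clear′ : ∀ u → row u ≡ row a → col a < col u → col u < col w → u ∉ B
    clear′ u ru a<u u<w with m≤n⇒m<n∨m≡n (≤-pred (subst (col u <_) cw u<w))
    ... | inj₁ u<v = clear u ru a<u u<v
    ... | inj₂ u≡v = subst (_∉ B) (vertex-ext (trans rv (sym ru)) (sym u≡v)) v∉B

  Unblocked-induction : ∀ {B} {P : V → Set} {a} → (∀ v → RightStep a v → P v) →
                        (∀ v w → P v → v ∉ B → RightStep v w → P w) →
                        ∀ {b} → Unblocked B a b → P b
  Unblocked-induction {B} {P} {a} start step {b} (rb , a<b , clear) =
    reach (col b ∸ suc (col a)) b rb (trans (sym (m∸n+n≡m a<b)) (+-suc _ (col a))) ≤-refl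
    where
    reach : ∀ d v → row v ≡ row a → col v ≡ suc (d + col a) → col v ≤ col b → P v
    reach zero    v rv cv _   = start v (rv , cv)
    reach (suc d) v rv cv v≤b =
      step u v (reach d u ru cu u≤b) u∉B (trans rv (sym ru) , trans cv (cong suc (sym cu)))
      where
      u<v : suc (d + col a) < col v
      u<v = ≤-reflexive (sym cv)
      u = vertex (row< a) (<-trans u<v (col< v))
      ru = row-vertex (row< a) (<-trans u<v (col< v))
      cu = col-vertex (row< a) (<-trans u<v (col< v))
      u≤b : col u ≤ col b
      u≤b = ≤-trans (≤-reflexive cu) (≤-trans (<⇒≤ u<v) v≤b)
      u∉B : u ∉ B
      u∉B = clear u ru (subst (col a <_) (sym cu) (s≤s (m≤n+m (col a) d)))
                       (<-≤-trans (subst (_< col v) (sym cu) u<v) v≤b)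

  module Semantics {l} {L : Labels l} {σ : Fin l → Subset (m * W)} (lab : Labelled L σ) where

    infix 4 _⊨_
    _⊨_ : ∀ {k} → (Fin k → V) → Formula k l → Set
    ρ ⊨ φ = Sat graph ρ σ φ

    ∈residue⇔ : ∀ {v z} → v ∈ σ (residueˡ L z) ⇔ residue (col v) ≡ z
    ∈residue⇔ {v} {z} = subst (λ S → v ∈ S ⇔ residue (col v) ≡ z) (sym (residue-set lab z))
                               (∈-toSubset (residueIs? z))

    ∈letter⇔ : ∀ {v ℓ} → v ∈ σ (letterˡ L ℓ) ⇔ α (col v) ≡ ℓ
    ∈letter⇔ {v} {ℓ} = subst (λ S → v ∈ S ⇔ α (col v) ≡ ℓ) (sym (letter-set lab ℓ))
                              (∈-toSubset (letterIs? ℓ))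

    module _ {k} {ρ : Fin k → V} {x : Fin k} {P : Set} (P? : Dec P) where

      byResidue⇔ : {φ : Residue → Formula k l} →
                   (∀ z → residue (col (ρ x)) ≡ z → ρ ⊨ φ z ⇔ P) → ρ ⊨ byResidue L x φ ⇔ P
      byResidue⇔ {φ} φ⇔ = mk⇔
        (λ sat → decidable-stable P? λ ¬p →
          case (residue (col (ρ x))) sat (from ∈residue⇔ refl , λ s → ¬p (to (φ⇔ _ refl) s)))
        (λ p → holds p r₀ , holds p r₁ , holds p r₂)
        where
        holds : P → ∀ z → ρ ⊨ mem x (residueˡ L z) ⇒ᶠ φ z
        holds p z (x∈ , ¬φ) = ¬φ (from (φ⇔ z (to ∈residue⇔ x∈)) p)
        case : ∀ z → ρ ⊨ byResidue L x φ → ρ ⊨ mem x (residueˡ L z) ⇒ᶠ φ z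
        case r₀ (c , _ , _) = c
        case r₁ (_ , c , _) = c
        case r₂ (_ , _ , c) = c

      byLetter⇔ : {φ : Letter → Formula k l} →
                  (∀ ℓ → α (col (ρ x)) ≡ ℓ → ρ ⊨ φ ℓ ⇔ P) → ρ ⊨ byLetter L x φ ⇔ P
      byLetter⇔ {φ} φ⇔ = mk⇔
        (λ sat → decidable-stable P? λ ¬p →
          case (α (col (ρ x))) sat (from ∈letter⇔ refl , λ s → ¬p (to (φ⇔ _ refl) s)))
        (λ p → holds p l0 , holds p l1 , holds p l2)
        where
        holds : P → ∀ ℓ → ρ ⊨ mem x (letterˡ L ℓ) ⇒ᶠ φ ℓ
        holds p ℓ (x∈ , ¬φ) = ¬φ (from (φ⇔ ℓ (to ∈letter⇔ x∈)) p)
        case : ∀ ℓ → ρ ⊨ byLetter L x φ → ρ ⊨ mem x (letterˡ L ℓ) ⇒ᶠ φ ℓ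
        case l0 (c , _ , _) = c
        case l1 (_ , c , _) = c
        case l2 (_ , _ , c) = c

    residueMap⇔ : ∀ {k} (ρ : Fin k → V) f x y →
                  ρ ⊨ residueMapᶠ L f x y ⇔ residue (col (ρ y)) ≡ f (residue (col (ρ x)))
    residueMap⇔ ρ f x y =
      byResidue⇔ {ρ = ρ} {x} (_ ≟ʳ _) {λ z → mem y (residueˡ L (f z))} λ { _ refl → ∈residue⇔ }

    module _ {k} (ρ : Fin k → V) (x y : Fin k) where

      rightStep₀⇔ : α (col (ρ x)) ≡ l0 → ρ ⊨ rightStepᶠ l0 L x y ⇔ RightStep (ρ x) (ρ y)
      rightStep₀⇔ a₀ = mk⇔ sound complete
        where
        sound : ρ ⊨ rightStepᶠ l0 L x y → RightStep (ρ x) (ρ y)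
        sound (ρy , xy) = sym (Adj⇒ColRel a₀ (adj⇒Adj xy) c) , c
          where c = Adj-right (adj⇒Adj xy) (to (residueMap⇔ ρ rsuc x y) ρy)
        complete : RightStep (ρ x) (ρ y) → ρ ⊨ rightStepᶠ l0 L x y
        complete (r , c) = from (residueMap⇔ ρ rsuc x y) (residue-right c) ,
                           Adj⇒adj (ColRel⇒Adj a₀ c (sym r))

      rightStep₁⇔ : α (col (ρ x)) ≡ l1 → ρ ⊨ rightStepᶠ l1 L x y ⇔ RightStep (ρ x) (ρ y)
      rightStep₁⇔ a₁ = mk⇔ sound complete
        where
        sound : ρ ⊨ rightStepᶠ l1 L x y → RightStep (ρ x) (ρ y)
        sound (ρy , ¬xy , w , u , xw , wu , uy , ρu) = r , c
          where
          ρu≡ρx : residue (col (ρ x)) ≡ residue (col u)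
          ρu≡ρx = to (residueMap⇔ (extend u (extend w ρ)) (λ z → z) #0 (Fin.suc (Fin.suc x))) ρu
          cu : col u ≡ col (ρ x)
          cu = Adj²-sameColumn (adj⇒Adj xw) (adj⇒Adj wu) (sym ρu≡ρx)
          c : col (ρ y) ≡ suc (col (ρ x))
          c = trans (Adj-right (adj⇒Adj uy) (trans (to (residueMap⇔ ρ rsuc x y) ρy) (cong rsuc ρu≡ρx)))
                    (cong suc cu)
          r : row (ρ y) ≡ row (ρ x)
          r = decidable-stable (_ ≟ _) λ r≢ → ¬xy (Adj⇒adj (ColRel⇒Adj a₁ c (r≢ ∘ sym)))
        complete : RightStep (ρ x) (ρ y) → ρ ⊨ rightStepᶠ l1 L x y
        complete (r , c) =
          from (residueMap⇔ ρ rsuc x y) (residue-right c) ,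
          (λ xy → Adj⇒ColRel a₁ (adj⇒Adj xy) c (sym r)) ,
          w , u , Adj⇒adj xw , Adj⇒adj wu , Adj⇒adj uy ,
          from (residueMap⇔ (extend u (extend w ρ)) (λ z → z) #0 (Fin.suc (Fin.suc x)))
               (cong residue (sym cu))
          where
          avoid₁ = avoid-two (row (ρ x)) (row (ρ x))
          avoid₂ = avoid-two (row (ρ x)) (proj₁ avoid₁)
          rw<m = ≤-trans (proj₁ (proj₂ avoid₁)) 3≤m
          ru<m = ≤-trans (proj₁ (proj₂ avoid₂)) 3≤m
          cw<W = subst (_< W) c (col< (ρ y))
          w = vertex rw<m cw<W
          u = vertex ru<m (col< (ρ x))
          cw : col w ≡ suc (col (ρ x))
          cw = col-vertex rw<m cw<W
          cu : col u ≡ col (ρ x)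
          cu = col-vertex ru<m (col< (ρ x))
          rw≢ : row (ρ x) ≢ row w
          rw≢ e = proj₁ (proj₂ (proj₂ avoid₁)) (trans (sym (row-vertex rw<m cw<W)) (sym e))
          ru≢ : ∀ {r} → r ≡ row (ρ x) ⊎ r ≡ row w → row u ≢ r
          ru≢ (inj₁ refl) e = proj₁ (proj₂ (proj₂ avoid₂)) (trans (sym (row-vertex ru<m (col< (ρ x)))) e)
          ru≢ (inj₂ refl) e = proj₂ (proj₂ (proj₂ avoid₂))
            (trans (sym (row-vertex ru<m (col< (ρ x)))) (trans e (row-vertex rw<m cw<W)))
          a₁u : α (col u) ≡ l1
          a₁u = trans (cong α cu) a₁
          xw : Adj (ρ x) w
          xw = ColRel⇒Adj a₁ cw rw≢
          wu : Adj w u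
          wu = Adj-sym (ColRel⇒Adj a₁u (trans cw (cong suc (sym cu))) (ru≢ (inj₂ refl)))
          uy : Adj u (ρ y)
          uy = ColRel⇒Adj a₁u (trans c (cong suc (sym cu))) (ru≢ (inj₁ r))

      rightStep₂⇔ : α (col (ρ x)) ≡ l2 → ρ ⊨ rightStepᶠ l2 L x y ⇔ RightStep (ρ x) (ρ y)
      rightStep₂⇔ a₂ = mk⇔ sound complete
        where
        sound : ρ ⊨ rightStepᶠ l2 L x y → RightStep (ρ x) (ρ y)
        sound (ρy , xy , ¬witness) = ≤-antisym y≤x x≤y , c
          where
          c = Adj-right (adj⇒Adj xy) (to (residueMap⇔ ρ rsuc x y) ρy)
          x≤y = Adj⇒ColRel a₂ (adj⇒Adj xy) c
          y≤x : row (ρ y) ≤ row (ρ x)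
          y≤x = decidable-stable (_ ≤? _) λ y≰x →
            let z = vertex (row< (ρ y)) (col< (ρ x))
                w = vertex (row< (ρ x)) (col< (ρ y))
                rz = row-vertex (row< (ρ y)) (col< (ρ x))
                cz = col-vertex (row< (ρ y)) (col< (ρ x))
                rw = row-vertex (row< (ρ x)) (col< (ρ y))
                cw = trans (col-vertex (row< (ρ x)) (col< (ρ y))) c
                a₂z = trans (cong α cz) a₂
            in ¬witness (z ,
                 from (residueMap⇔ (extend z ρ) (λ z → z) #0 (Fin.suc x)) (cong residue (sym cz)) ,
                 Adj⇒adj (Adj-sym (ColRel⇒Adj a₂z (trans c (cong suc (sym cz))) (≤-reflexive rz))) ,
                 w ,
                 from (residueMap⇔ (extend w (extend z ρ)) rsuc (Fin.suc (Fin.suc x)) #0)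
                      (residue-right cw) ,
                 Adj⇒adj (ColRel⇒Adj a₂ cw (≤-reflexive (sym rw))) ,
                 λ zw → y≰x (subst₂ _≤_ rz rw
                   (Adj⇒ColRel a₂z (adj⇒Adj zw) (trans cw (cong suc (sym cz))))))
        complete : RightStep (ρ x) (ρ y) → ρ ⊨ rightStepᶠ l2 L x y
        complete (r , c) = from (residueMap⇔ ρ rsuc x y) (residue-right c) ,
                           Adj⇒adj (ColRel⇒Adj a₂ c (≤-reflexive (sym r))) ,
                           ¬witness
          where
          ¬witness : ρ ⊨ neg (rowExceedsᶠ L x y)
          ¬witness (z , ρz , yz , w , ρw , xw , ¬zw) =
            ¬zw (Adj⇒adj (ColRel⇒Adj a₂z cw (≤-trans z≤y (≤-trans (≤-reflexive r) x≤w))))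
            where
            ρz≡ρx = to (residueMap⇔ (extend z ρ) (λ z → z) #0 (Fin.suc x)) ρz
            cz : col z ≡ col (ρ x)
            cz = suc-injective (trans (sym (Adj-right (Adj-sym (adj⇒Adj yz))
                   (trans (residue-right c) (cong rsuc ρz≡ρx)))) c)
            a₂z = trans (cong α cz) a₂
            z≤y = Adj⇒ColRel a₂z (Adj-sym (adj⇒Adj yz)) (trans c (cong suc (sym cz)))
            cw₀ = Adj-right (adj⇒Adj xw)
                    (to (residueMap⇔ (extend w (extend z ρ)) rsuc (Fin.suc (Fin.suc x)) #0) ρw)
            x≤w = Adj⇒ColRel a₂ (adj⇒Adj xw) cw₀
            cw = trans cw₀ (cong suc (sym cz))

    rightStep⇔ : ∀ {k} (ρ : Fin k → V) x y → ρ ⊨ rightᶠ L x y ⇔ RightStep (ρ x) (ρ y)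
    rightStep⇔ ρ x y = byLetter⇔ {ρ = ρ} {x} (rightStep? _ _) {λ ℓ → rightStepᶠ ℓ L x y} λ
      { l0 a → rightStep₀⇔ ρ x y a
      ; l1 a → rightStep₁⇔ ρ x y a
      ; l2 a → rightStep₂⇔ ρ x y a }

    sameColumn-sound : ∀ {k} (ρ : Fin k → V) x y → ρ ⊨ sameColumnᶠ L x y → col (ρ y) ≡ col (ρ x)
    sameColumn-sound ρ x y (ρy , w , xw , yw , _) =
      Adj²-sameColumn (adj⇒Adj xw) (Adj-sym (adj⇒Adj yw)) (to (residueMap⇔ ρ (λ z → z) x y) ρy)

    sameColumn-complete : ∀ {k} (ρ : Fin k → V) x y → α (col (ρ x)) ≢ l0 → col (ρ y) ≡ col (ρ x) →
                          suc (col (ρ x)) < W → ρ ⊨ sameColumnᶠ L x y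
    sameColumn-complete ρ x y ¬a₀ cy c<W =
      let (w , cw , xw , yw) = commonRightNeighbour ¬a₀ cy c<W
      in from (residueMap⇔ ρ (λ z → z) x y) (cong residue cy) , w , Adj⇒adj xw , Adj⇒adj yw ,
         from (residueMap⇔ (extend w ρ) rsuc (Fin.suc x) #0) (residue-right cw)

  unblocked⇔ : ∀ {l L σ} → Labelled {l} L σ → ∀ {k} (ρ : Fin k → V) B x y →
               Sat graph ρ σ (unblockedᶠ L B x y) ⇔ Unblocked (σ B) (ρ x) (ρ y)
  unblocked⇔ {L = L} {σ} lab ρ B x y = mk⇔ sound complete
    where
    step⇔ : ∀ X {k} (ρ′ : Fin k → V) u v →
            Sat graph ρ′ (extend X σ) (rightᶠ (weaken L) u v) ⇔ RightStep (ρ′ u) (ρ′ v)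
    step⇔ X = Semantics.rightStep⇔ (weaken-labelled X lab)
    sound : Sat graph ρ σ (unblockedᶠ L B x y) → Unblocked (σ B) (ρ x) (ρ y)
    sound sat = decidable-stable (unblocked? (σ B) (ρ x) (ρ y)) λ ¬U →
      sat (X , start , closed , λ y∈X → ¬U (to ∈X⇔ y∈X))
      where
      X = toSubset (unblocked? (σ B) (ρ x))
      ∈X⇔ : ∀ {v} → v ∈ X ⇔ Unblocked (σ B) (ρ x) v
      ∈X⇔ = ∈-toSubset (unblocked? (σ B) (ρ x))
      start : Sat graph ρ (extend X σ) (rightNeighbour∈ᶠ (weaken L) x #0)
      start (v , xv , v∉X) =
        v∉X (from ∈X⇔ (RightStep⇒Unblocked (to (step⇔ X (extend v ρ) (Fin.suc x) #0) xv)))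
      closed : Sat graph ρ (extend X σ) (closedRightOutsideᶠ (weaken L) (Fin.suc B) #0)
      closed (v , w , v∈X , v∉B , vw , w∉X) =
        w∉X (from ∈X⇔ (Unblocked-step (to ∈X⇔ v∈X) v∉B
                                   (to (step⇔ X (extend w (extend v ρ)) #1 #0) vw)))
    complete : Unblocked (σ B) (ρ x) (ρ y) → Sat graph ρ σ (unblockedᶠ L B x y)
    complete U (X , start , closed , y∉X) = y∉X (Unblocked-induction {P = _∈ X}
      (λ v xv → decidable-stable (v ∈? X) λ v∉X →
        start (v , from (step⇔ X (extend v ρ) (Fin.suc x) #0) xv , v∉X))
      (λ v w v∈X v∉B vw → decidable-stable (w ∈? X) λ w∉X →
        closed (v , w , v∈X , v∉B , from (step⇔ X (extend w (extend v ρ)) #1 #0) vw , w∉X))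
      U)

Dˡ Lˡ Mˡ Zˡ : Fin 10
Dˡ = # 0
Lˡ = # 1
Mˡ = # 2
Zˡ = # 3

gridLabels : Labels 10
gridLabels = record
  { residueˡ = λ { r₀ → # 4 ; r₁ → # 5 ; r₂ → # 6 }
  ; letterˡ  = λ { l0 → # 7 ; l1 → # 8 ; l2 → # 9 } }

horizontalᶠ : ∀ {k} → Fin k → Fin k → Formula k 10
horizontalᶠ = unblockedᶠ gridLabels Dˡ

-- Z is interpreted as the empty set, so unblockedᶠ with Zˡ says "right of, in the
-- same row"; the last conjunct makes the markers of the two rows consecutive.
verticalᶠ : ∀ {k} → Fin k → Fin k → Formula k 10
verticalᶠ x y = and (sameColumnᶠ gridLabels x y)
  (ex₁ (and (mem #0 Mˡ) (and (unblockedᶠ gridLabels Zˡ (Fin.suc x) #0)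
  (ex₁ (and (sameColumnᶠ gridLabels #1 #0) (and (unblockedᶠ gridLabels Zˡ (Fin.suc (Fin.suc y)) #0)
  (ex₁ (and (mem #0 Mˡ) (unblockedᶠ gridLabels Lˡ #1 #0)))))))))

gridInterpretation : Interpretation 10
gridInterpretation = record
  { dom  = mem #0 Dˡ
  ; edgE = horizontalᶠ #0 #1 ∨ᶠ (horizontalᶠ #1 #0 ∨ᶠ (verticalᶠ #0 #1 ∨ᶠ verticalᶠ #1 #0)) }

-- The grid vertex (i , j) is v_{i, q j}.  D holds these vertices, L the columns
-- q (n + s) and M the vertices v_{i, q (n + i)}, for i, j, s < n.
module Grid (α : ℕ → Letter) (q : ℕ → ℕ) (q-letter : ∀ t → α (q t) ≢ l0)
            (q-step : ∀ t → q t < q (suc t)) (n : ℕ) where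

  open StrictlyIncreasing q q-step

  open Rectangle α (3 + n) (2 + q (n + n)) (s≤s (s≤s (s≤s z≤n))) public

  row-bound : ∀ {r} → r < n → r < 3 + n
  row-bound r<n = <-≤-trans r<n (m≤n+m n 3)

  next-bound : ∀ {s} → s ≤ n + n → suc (q s) < 2 + q (n + n)
  next-bound s≤ = s≤s (s≤s (mono-≤ s≤))

  col-bound : ∀ {s} → s ≤ n + n → q s < 2 + q (n + n)
  col-bound s≤ = <-trans (n<1+n _) (next-bound s≤)

  Domain Level Marker : V → Set
  Domain v = row v < n × Σ (Fin n) λ s → col v ≡ q (toℕ s)
  Level  v = Σ (Fin n) λ s → col v ≡ q (n + toℕ s)
  Marker v = row v < n × col v ≡ q (n + row v)

  domain? : ∀ v → Dec (Domain v)
  domain? v = (row v <? n) ×-dec any? (λ s → col v ≟ q (toℕ s))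

  level? : ∀ v → Dec (Level v)
  level? v = any? (λ s → col v ≟ q (n + toℕ s))

  marker? : ∀ v → Dec (Marker v)
  marker? v = (row v <? n) ×-dec (col v ≟ q (n + row v))

  assignment : Fin 10 → Subset (size graph)
  assignment = lookup (toSubset domain? ∷ toSubset level? ∷ toSubset marker? ∷ ⊥ ∷
                       toSubset (residueIs? r₀) ∷ toSubset (residueIs? r₁) ∷ toSubset (residueIs? r₂) ∷
                       toSubset (letterIs? l0) ∷ toSubset (letterIs? l1) ∷ toSubset (letterIs? l2) ∷ [])

  labelled : Labelled gridLabels assignment
  labelled = record
    { residue-set = λ { r₀ → refl ; r₁ → refl ; r₂ → refl }
    ; letter-set  = λ { l0 → refl ; l1 → refl ; l2 → refl } }

  open Semantics labelled

  cell : ∀ {r s} → r < 3 + n → s ≤ n + n → V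
  cell r< s≤ = vertex r< (col-bound s≤)

  row-cell : ∀ {r s} (r< : r < 3 + n) (s≤ : s ≤ n + n) → row (cell r< s≤) ≡ r
  row-cell r< s≤ = row-vertex r< (col-bound s≤)

  col-cell : ∀ {r s} (r< : r < 3 + n) (s≤ : s ≤ n + n) → col (cell r< s≤) ≡ q s
  col-cell r< s≤ = col-vertex r< (col-bound s≤)

  toℕ≤n+n : (j : Fin n) → toℕ j ≤ n + n
  toℕ≤n+n j = ≤-trans (<⇒≤ (toℕ<n j)) (m≤m+n n n)

  n+<n⇒≤n+n : ∀ {s} → s < n → n + s ≤ n + n
  n+<n⇒≤n+n s<n = +-monoʳ-≤ n (<⇒≤ s<n)

  embed : Fin n × Fin n → V
  embed (i , j) = cell (row-bound (toℕ<n i)) (toℕ≤n+n j)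

  row-embed : ∀ p → row (embed p) ≡ toℕ (proj₁ p)
  row-embed (i , j) = row-cell (row-bound (toℕ<n i)) (toℕ≤n+n j)

  col-embed : ∀ p → col (embed p) ≡ q (toℕ (proj₂ p))
  col-embed (i , j) = col-cell (row-bound (toℕ<n i)) (toℕ≤n+n j)

  marker : ∀ {r} → r < n → V
  marker r<n = cell (row-bound r<n) (n+<n⇒≤n+n r<n)

  row-marker : ∀ {r} (r<n : r < n) → row (marker r<n) ≡ r
  row-marker r<n = row-cell (row-bound r<n) (n+<n⇒≤n+n r<n)

  col-marker : ∀ {r} (r<n : r < n) → col (marker r<n) ≡ q (n + r)
  col-marker r<n = col-cell (row-bound r<n) (n+<n⇒≤n+n r<n)

  marker∈M : ∀ {r} (r<n : r < n) → marker r<n ∈ assignment Mˡ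
  marker∈M r<n = from (∈-toSubset marker?)
    (subst (_< n) (sym (row-marker r<n)) r<n ,
     trans (col-marker r<n) (cong (λ r → q (n + r)) (sym (row-marker r<n))))

  level-cell∈L : ∀ {r s} (r< : r < 3 + n) (s<n : s < n) → cell r< (n+<n⇒≤n+n s<n) ∈ assignment Lˡ
  level-cell∈L r< s<n = from (∈-toSubset level?)
    (fromℕ< s<n , trans (col-cell r< (n+<n⇒≤n+n s<n)) (cong (λ s → q (n + s)) (sym (toℕ-fromℕ< s<n))))

  domain-on-q : ∀ v → v ∈ assignment Dˡ → Σ ℕ λ t → col v ≡ q t
  domain-on-q v v∈D = let (_ , s , cv) = to (∈-toSubset domain?) v∈D in toℕ s , cv

  level-on-q : ∀ v → v ∈ assignment Lˡ → Σ ℕ λ t → col v ≡ q t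
  level-on-q v v∈L = let (s , cv) = to (∈-toSubset level?) v∈L in n + toℕ s , cv

  sameColumn-on-q : ∀ {k} (ρ : Fin k → V) x y {t} → col (ρ x) ≡ q t → t ≤ n + n →
                    col (ρ y) ≡ col (ρ x) → ρ ⊨ sameColumnᶠ gridLabels x y
  sameColumn-on-q ρ x y {t} cx t≤ cy = sameColumn-complete ρ x y
    (subst (_≢ l0) (cong α (sym cx)) (q-letter t)) cy
    (subst (λ c → suc c < 2 + q (n + n)) (sym cx) (next-bound t≤))

  embed-injective : ∀ {p p′} → embed p ≡ embed p′ → p ≡ p′
  embed-injective {i , j} {i′ , j′} e = cong₂ _,_
    (toℕ-injective (trans (sym (row-embed (i , j))) (trans (cong row e) (row-embed (i′ , j′)))))
    (toℕ-injective (injective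
      (trans (sym (col-embed (i , j))) (trans (cong col e) (col-embed (i′ , j′))))))

  embed-domain : ∀ p → embed p ∈ assignment Dˡ
  embed-domain (i , j) = from (∈-toSubset domain?)
    (subst (_< n) (sym (row-embed (i , j))) (toℕ<n i) , j , col-embed (i , j))

  domain⇔image : ∀ v → v ∈ assignment Dˡ ⇔ (∃[ p ] embed p ≡ v)
  domain⇔image v = mk⇔ image λ { (p , refl) → embed-domain p }
    where
    image : v ∈ assignment Dˡ → ∃[ p ] embed p ≡ v
    image v∈D with to (∈-toSubset domain?) v∈D
    ... | r<n , s , cs = (fromℕ< r<n , s) ,
      vertex-ext (trans (row-embed (fromℕ< r<n , s)) (toℕ-fromℕ< r<n))
                 (trans (col-embed (fromℕ< r<n , s)) (sym cs))

  consecutive : ∀ {B a b s t} → Unblocked B a b → col a ≡ q s → col b ≡ q t →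
                (suc s < t → Σ V λ v → row v ≡ row a × col v ≡ q (suc s) × v ∈ B) → t ≡ suc s
  consecutive {s = s} (_ , a<b , clear) ca cb between = ≤-antisym
    (≮⇒≥ λ s+1<t → let (v , rv , cv , v∈B) = between s+1<t in
      clear v rv (subst₂ _<_ (sym ca) (sym cv) (mono-< (n<1+n s)))
                 (subst₂ _<_ (sym cv) (sym cb) (mono-< s+1<t)) v∈B)
    (cancel-< (subst₂ _<_ ca cb a<b))

  consecutive⇒Unblocked : ∀ {B a b s} → row b ≡ row a → col a ≡ q s → col b ≡ q (suc s) →
                          (∀ v → v ∈ B → Σ ℕ λ t → col v ≡ q t) → Unblocked B a b
  consecutive⇒Unblocked {s = s} rb ca cb onColumns =
    rb , subst₂ _<_ (sym ca) (sym cb) (mono-< (n<1+n s)) ,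
    λ v _ a<v v<b v∈B → let (t , cv) = onColumns v v∈B in
      <⇒≱ (cancel-< (subst₂ _<_ ca cv a<v)) (≤-pred (cancel-< (subst₂ _<_ cv cb v<b)))

  Unblocked-∅ : ∀ {a b} → row b ≡ row a → col a < col b → Unblocked ⊥ a b
  Unblocked-∅ rb a<b = rb , a<b , λ _ _ _ _ → ∉⊥

  Right Down : Fin n × Fin n → Fin n × Fin n → Set
  Right (i , j) (i′ , j′) = i ≡ i′ × toℕ j′ ≡ suc (toℕ j)
  Down  (i , j) (i′ , j′) = j ≡ j′ × toℕ i′ ≡ suc (toℕ i)

  right? : ∀ p p′ → Dec (Right p p′)
  right? (i , j) (i′ , j′) = (i Fin.≟ i′) ×-dec (toℕ j′ ≟ suc (toℕ j))

  down? : ∀ p p′ → Dec (Down p p′)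
  down? (i , j) (i′ , j′) = (j Fin.≟ j′) ×-dec (toℕ i′ ≟ suc (toℕ i))

  horizontal⇔ : ∀ p p′ → Unblocked (assignment Dˡ) (embed p) (embed p′) ⇔ Right p p′
  horizontal⇔ (i , j) (i′ , j′) = mk⇔ sound complete
    where
    sound : Unblocked (assignment Dˡ) (embed (i , j)) (embed (i′ , j′)) → Right (i , j) (i′ , j′)
    sound U =
      toℕ-injective (trans (sym (row-embed (i , j))) (trans (sym (proj₁ U)) (row-embed (i′ , j′)))) ,
      consecutive {a = embed (i , j)} {embed (i′ , j′)} U
                  (col-embed (i , j)) (col-embed (i′ , j′)) between
      where
      between : suc (toℕ j) < toℕ j′ →
                Σ V λ v → row v ≡ row (embed (i , j)) × col v ≡ q (suc (toℕ j)) × v ∈ assignment Dˡ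
      between j+1<j′ = embed (i , s) , trans (row-embed (i , s)) (sym (row-embed (i , j))) ,
                       trans (col-embed (i , s)) (cong q (toℕ-fromℕ< j+1<n)) , embed-domain (i , s)
        where
        j+1<n = <-trans j+1<j′ (toℕ<n j′)
        s = fromℕ< j+1<n
    complete : Right (i , j) (i′ , j′) → Unblocked (assignment Dˡ) (embed (i , j)) (embed (i′ , j′))
    complete (refl , j′≡j+1) = consecutive⇒Unblocked {a = embed (i , j)} {embed (i , j′)}
      (trans (row-embed (i , j′)) (sym (row-embed (i , j)))) (col-embed (i , j))
      (trans (col-embed (i , j′)) (cong q j′≡j+1)) domain-on-q

  vertical-sound : ∀ {k} (ρ : Fin k → V) x y → row (ρ y) < n → ρ ⊨ verticalᶠ x y →
                   col (ρ y) ≡ col (ρ x) × row (ρ y) ≡ suc (row (ρ x))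
  vertical-sound ρ x y y<n (xy , e , e∈M , xe , u , eu , yu , e′ , e′∈M , ue′) =
    sameColumn-sound ρ x y xy , +-cancelˡ-≡ n _ _ (trans n+i′≡ (sym (+-suc n _)))
    where
    i = row (ρ x)
    i′ = row (ρ y)
    ρ₁ = extend e ρ
    ρ₂ = extend u ρ₁
    U = to (unblocked⇔ labelled (extend e′ ρ₂) Lˡ #1 #0) ue′
    re : row e ≡ i
    re = proj₁ (to (unblocked⇔ labelled ρ₁ Zˡ (Fin.suc x) #0) xe)
    ru : row u ≡ i′
    ru = proj₁ (to (unblocked⇔ labelled ρ₂ Zˡ (Fin.suc (Fin.suc y)) #0) yu)
    cu : col u ≡ q (n + i)
    cu = trans (sameColumn-sound ρ₂ #1 #0 eu)
               (trans (proj₂ (to (∈-toSubset marker?) e∈M)) (cong (λ r → q (n + r)) re))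
    ce′ : col e′ ≡ q (n + i′)
    ce′ = trans (proj₂ (to (∈-toSubset marker?) e′∈M)) (cong (λ r → q (n + r)) (trans (proj₁ U) ru))
    between : suc (n + i) < n + i′ →
              Σ V λ v → row v ≡ row u × col v ≡ q (suc (n + i)) × v ∈ assignment Lˡ
    between lt = cell (row< u) (n+<n⇒≤n+n i+1<n) , row-cell (row< u) (n+<n⇒≤n+n i+1<n) ,
                 trans (col-cell (row< u) (n+<n⇒≤n+n i+1<n)) (cong q (+-suc n i)) ,
                 level-cell∈L (row< u) i+1<n
      where
      i+1<n : suc i < n
      i+1<n = <-trans (+-cancelˡ-< n _ _ (subst (_< n + i′) (sym (+-suc n i)) lt)) y<n
    n+i′≡ : n + i′ ≡ suc (n + i)
    n+i′≡ = consecutive {a = u} {e′} U cu ce′ between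

  vertical-complete : ∀ {k} (ρ : Fin k → V) x y {t} → t < n → col (ρ x) ≡ q t → row (ρ y) < n →
                      col (ρ y) ≡ col (ρ x) → row (ρ y) ≡ suc (row (ρ x)) → ρ ⊨ verticalᶠ x y
  vertical-complete ρ x y {t} t<n cx y<n cy ry =
    sameColumn-on-q ρ x y cx (≤-trans (<⇒≤ t<n) (m≤m+n n n)) cy ,
    e , marker∈M i<n ,
    from (unblocked⇔ labelled ρ₁ Zˡ (Fin.suc x) #0)
         (Unblocked-∅ {ρ x} {e} (row-marker i<n) (subst₂ _<_ (sym cx) (sym (col-marker i<n)) t<n+i)) ,
    u , sameColumn-on-q ρ₂ #1 #0 (col-marker i<n) (n+<n⇒≤n+n i<n) (trans cu (sym (col-marker i<n))) ,
    from (unblocked⇔ labelled ρ₂ Zˡ (Fin.suc (Fin.suc y)) #0)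
         (Unblocked-∅ {ρ y} {u} ru (subst₂ _<_ (sym (trans cy cx)) (sym cu) t<n+i)) ,
    e′ , marker∈M y<n ,
    from (unblocked⇔ labelled (extend e′ ρ₂) Lˡ #1 #0)
         (consecutive⇒Unblocked {a = u} {e′} (trans (row-marker y<n) (sym ru)) cu ce′ level-on-q)
    where
    i = row (ρ x)
    i<n : i < n
    i<n = <-trans (n<1+n i) (subst (_< n) ry y<n)
    t<n+i : q t < q (n + i)
    t<n+i = mono-< (<-≤-trans t<n (m≤m+n n i))
    e = marker i<n
    e′ = marker y<n
    u = cell (row-bound y<n) (n+<n⇒≤n+n i<n)
    ρ₁ = extend e ρ
    ρ₂ = extend u ρ₁
    ru : row u ≡ row (ρ y)
    ru = row-cell (row-bound y<n) (n+<n⇒≤n+n i<n)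
    cu : col u ≡ q (n + i)
    cu = col-cell (row-bound y<n) (n+<n⇒≤n+n i<n)
    ce′ : col e′ ≡ q (suc (n + i))
    ce′ = trans (col-marker y<n) (cong q (trans (cong (n +_) ry) (+-suc n i)))

  vertical⇔ : ∀ {k} (ρ : Fin k → V) x y {p p′} → ρ x ≡ embed p → ρ y ≡ embed p′ →
              ρ ⊨ verticalᶠ x y ⇔ Down p p′
  vertical⇔ ρ x y {i , j} {i′ , j′} ex ey = mk⇔ sound complete
    where
    rx = trans (cong row ex) (row-embed (i , j))
    ry = trans (cong row ey) (row-embed (i′ , j′))
    cx = trans (cong col ex) (col-embed (i , j))
    cy = trans (cong col ey) (col-embed (i′ , j′))
    y<n : row (ρ y) < n
    y<n = subst (_< n) (sym ry) (toℕ<n i′)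
    sound : ρ ⊨ verticalᶠ x y → Down (i , j) (i′ , j′)
    sound sat = let (c , r) = vertical-sound ρ x y y<n sat in
      toℕ-injective (injective (trans (sym cx) (trans (sym c) cy))) ,
      trans (sym ry) (trans r (cong suc rx))
    complete : Down (i , j) (i′ , j′) → ρ ⊨ verticalᶠ x y
    complete (refl , i′≡i+1) = vertical-complete ρ x y (toℕ<n j) cx y<n (trans cy (sym cx))
                                                 (trans ry (trans i′≡i+1 (cong suc (sym rx))))

  GridStep : Fin n × Fin n → Fin n × Fin n → Set
  GridStep p p′ = Right p p′ ⊎ (Right p′ p ⊎ (Down p p′ ⊎ Down p′ p))

  GridAdj⇔GridStep : ∀ p p′ → GridAdj p p′ ⇔ GridStep p p′
  GridAdj⇔GridStep (i , j) (i′ , j′) = mk⇔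
    (λ { (inj₁ (refl , inj₁ e)) → inj₁ (refl , e)
       ; (inj₁ (refl , inj₂ e)) → inj₂ (inj₁ (refl , e))
       ; (inj₂ (refl , inj₁ e)) → inj₂ (inj₂ (inj₁ (refl , e)))
       ; (inj₂ (refl , inj₂ e)) → inj₂ (inj₂ (inj₂ (refl , e))) })
    (λ { (inj₁ (refl , e))               → inj₁ (refl , inj₁ e)
       ; (inj₂ (inj₁ (refl , e)))        → inj₁ (refl , inj₂ e)
       ; (inj₂ (inj₂ (inj₁ (refl , e)))) → inj₂ (refl , inj₁ e)
       ; (inj₂ (inj₂ (inj₂ (refl , e)))) → inj₂ (refl , inj₂ e) })

  edge⇔ : ∀ p p′ → two (embed p) (embed p′) ⊨ edgE gridInterpretation ⇔ GridStep p p′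
  edge⇔ p p′ =
    ¬∧¬⇔⊎ (⇔-trans (unblocked⇔ labelled ρ Dˡ #0 #1) (horizontal⇔ p p′))
      (¬∧¬⇔⊎ (⇔-trans (unblocked⇔ labelled ρ Dˡ #1 #0) (horizontal⇔ p′ p))
        (¬∧¬⇔⊎ (vertical⇔ ρ #0 #1 refl refl) (vertical⇔ ρ #1 #0 refl refl)
          (down? p p′ ⊎-dec down? p′ p))
        (right? p′ p ⊎-dec (down? p p′ ⊎-dec down? p′ p)))
      (right? p p′ ⊎-dec (right? p′ p ⊎-dec (down? p p′ ⊎-dec down? p′ p)))
    where ρ = two (embed p) (embed p′)

  grid≅ : InterpIsoGrid gridInterpretation graph assignment n
  grid≅ = embed , embed-injective , domain⇔image ,
          λ p p′ → ⇔-trans (GridAdj⇔GridStep p p′) (⇔-sym (edge⇔ p p′))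

theorem4 : (α : ℕ → Letter) → InfinitelyMany α l1 ⊎ InfinitelyMany α l2 →
           Σ ℕ λ l → Σ (Interpretation l) λ Θ →
             ∀ n → Σ Graph λ G → InSα α G ×
               Σ (Fin l → Subset (size G)) λ A → InterpIsoGrid Θ G A n
theorem4 α often = 10 , gridInterpretation , λ n →
  let open Grid α q q≢l0 q-step n in graph , graph∈Sα , assignment , grid≅
  where
  enumeration = enumerate-nonzero often
  q = proj₁ enumeration
  q≢l0 = proj₁ (proj₂ enumeration)
  q-step = proj₂ (proj₂ enumeration)
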